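{- Let $L$ be an event log over a finite set of activities $A_L$, let $a_s,a_f\notin A_L$ ($a_s\ne a_f$) be the fresh start and end activities of the USE-transformation $L'=\mathrm{USE}(L)$, and let $\mathcal{C}$ be a causal relation oracle. Let $W=(P,T,F,p_i,p_o,\lambda)$ be the net returned by the ILP-Based Process Discovery algorithm on input $(L,\mathcal{C})$. If $W$ is a workflow net, then $W$ is relaxed sound.
   Context: An event log is a finite bag of finite sequences (traces) over a finite activity set $A_L$; $\overline{L}$ denotes the set of all prefixes (including $\epsilon$) of its traces; $\vec p(\sigma)$ is the Parikh vector of $\sigma$. $\mathrm{USE}(L)$ replaces each trace $\sigma$ of $L$ by $\langle a_s\rangle\cdot\sigma\cdot\langle a_f\rangle$. A causal relation oracle is any function mapping a bag of traces to a set of pairs of its activities. For $a,b\in A'=A_L\cup\{a_s,a_f\}$, $ILP_{(L',a\to b)}$ is the integer program over $m\in\{0,1\}$, $\vec x,\vec y\in\{0,1\}^{|A'|}$ (minimizing some fixed linear objective) with constraints: for every nonempty $\sigma=\sigma'\cdot\langle c\rangle\in\overline{L'}$, $m+\vec p(\sigma')^\top\vec x-\vec p(\sigma)^\top\vec y\ge0$; for every $\sigma\in L'$, $m+\vec p(\sigma)^\top(\vec x-\vec y)=0$; $\sum_c\vec x(c)+\sum_c\vec y(c)\ge1$; $m=0$, $\vec x(a)=1$, $\vec y(b)=1$. ILP-Based Process Discovery algorithm on $(L,\mathcal{C})$: set $T=\{t_c\mid c\in A'\}$, $P=F=\emptyset$. For each $(a,b)\in\mathcal{C}(L')$: take a solution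 $(m,\vec x,\vec y)$ of $ILP_{(L',a\to b)}$, add a new place $p_{(a,b)}$, and for each $c\in A'$ add arc $(t_c,p_{(a,b)})$ if $\vec x(c)=1$ and arc $(p_{(a,b)},t_c)$ if $\vec y(c)=1$. Then add new places $p_i,p_o$ with arcs $(p_i,t_{a_s})$ and $(t_{a_f},p_o)$. Labelling: $\lambda(t_c)=c$ for $c\in A_L$, $\lambda(t_{a_s})=\lambda(t_{a_f})=\tau$ (silent). Return $(P,T,F,p_i,p_o,\lambda)$. A WF-net is $(P,T,F,p_i,p_o,\lambda)$ with $p_i\ne p_o$, $\bullet p_i=\emptyset$, $p_o\bullet=\emptyset$, and every node on a directed path from $p_i$ to $p_o$ (where $\bullet x,x\bullet$ are pre- and post-sets w.r.t. $F$). A marking is a multiset of places. Transition $t$ is enabled in $M$ if $M(p)>0$ for all $p\in\bullet t$; firing it yields $M'$ with $M'(p)=M(p)-1$ for $p\in\bullet t\setminus t\bullet$, $M'(p)=M(p)+1$ for $p\in t\bullet\setminus\bullet t$, $M'(p)=M(p)$ otherwise; write $M\xrightarrow{t}M'$, and $M\rightsquigarrow M'$ if $M'$ is reachable from $M$ by a finite (possibly empty) sequence of firings. $W$ is relaxed sound iff for every $t\in T$ there exist markings $M,M'$ with $[p_i]\rightsquigarrow M$, $M\xrightarrow{t}M'$ and $M'\rightsquigarrow[p_o]$, where $[p]$ is the marking with one token in $p$ and none elsewhere. -}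

module Defs where

open import Data.Nat using (ℕ; zero; suc; _+_; _*_; _∸_; _≤_; _<_)
open import Data.Integer as ℤ using (ℤ; +_)
open import Data.Fin using (Fin; toℕ) renaming (zero to fzero; suc to fsuc)
open import Data.Fin.Properties using () renaming (_≟_ to _≟F_)
open import Data.Bool using (Bool; true; false; _∧_; not; if_then_else_)
open import Data.Maybe using (Maybe; just; nothing)
open import Data.List using (List; []; _∷_; _++_; [_]; map; filter; length; lookup; allFin)
open import Data.Nat.ListAction using (sum)
open import Data.List.Membership.Propositional using (_∈_)
open import Data.Product using (Σ; ∃; ∃-syntax; _×_; _,_)
open import Data.Sum using (_⊎_; inj₁; inj₂)
open import Data.Empty using (⊥)
open import Relation.Nullary using (¬_; Dec; yes; no)
open import Relation.Binary.PropositionalEquality using (_≡_; _≢_; refl; cong)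
open import Relation.Binary.Construct.Closure.ReflexiveTransitive using (Star)

-- Activities.  A_L is represented by Fin n; A' = A_L ∪ {a_s, a_f} by Act n,
-- where a_s (aₛ) and a_f (aₓ) are fresh and distinct by construction.

data Act (n : ℕ) : Set where
  aₛ  : Act n
  aₓ  : Act n
  act : Fin n → Act n

allActs : (n : ℕ) → List (Act n)
allActs n = aₛ ∷ aₓ ∷ map act (allFin n)

_≟A_ : {n : ℕ} → (a b : Act n) → Dec (a ≡ b)
aₛ ≟A aₛ = yes refl
aₛ ≟A aₓ = no λ ()
aₛ ≟A act _ = no λ ()
aₓ ≟A aₛ = no λ ()
aₓ ≟A aₓ = yes refl
aₓ ≟A act _ = no λ ()
act _ ≟A aₛ = no λ ()
act _ ≟A aₓ = no λ ()
act i ≟A act j with i ≟F j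
... | yes refl = yes refl
... | no i≢j = no λ { refl → i≢j refl }

-- Event logs: finite bags of finite traces (a bag is a list; order irrelevant).

Trace : Set → Set
Trace A = List A

Log : Set → Set
Log A = List (Trace A)

Occurs : {A : Set} → A → Log A → Set
Occurs a K = ∃[ σ ] (σ ∈ K × a ∈ σ)

InPrefixClosure : {A : Set} → Trace A → Log A → Set
InPrefixClosure σ K = ∃[ τ ] (τ ∈ K × ∃[ ρ ] (σ ++ ρ ≡ τ))

USE : {n : ℕ} → Log (Fin n) → Log (Act n)
USE L = map (λ σ → aₛ ∷ (map act σ ++ [ aₓ ])) L

record CausalOracle (n : ℕ) : Set where
  field
    rel      : Log (Act n) → List (Act n × Act n)
    its-acts : ∀ K a b → (a , b) ∈ rel K → Occurs a K × Occurs b K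

parikh : {n : ℕ} → Trace (Act n) → Act n → ℕ
parikh σ c = length (filter (c ≟A_) σ)

dot : {n : ℕ} → (Act n → ℕ) → (Act n → Fin 2) → ℕ
dot {n} p x = sum (map (λ c → p c * toℕ (x c)) (allActs n))

total : {n : ℕ} → (Act n → Fin 2) → ℕ
total {n} x = sum (map (λ c → toℕ (x c)) (allActs n))

record Candidate (n : ℕ) : Set where
  field
    m : Fin 2
    x : Act n → Fin 2
    y : Act n → Fin 2
open Candidate public

-- Feasibility.  The integer constraints m + p(σ')ᵀx − p(σ)ᵀy ≥ 0 and
-- m + p(σ)ᵀ(x − y) = 0 are written with the negative term moved to the
-- other side (all quantities are naturals).
Feasible : {n : ℕ} → Log (Act n) → Act n → Act n → Candidate n → Set
Feasible L' a b s =
    (∀ σ' c → InPrefixClosure (σ' ++ [ c ]) L' →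
        dot (parikh (σ' ++ [ c ])) (y s) ≤ toℕ (m s) + dot (parikh σ') (x s))
  × (∀ σ → σ ∈ L' → toℕ (m s) + dot (parikh σ) (x s) ≡ dot (parikh σ) (y s))
  × (1 ≤ total (x s) + total (y s))
  × (m s ≡ fzero)
  × (x s a ≡ fsuc fzero)
  × (y s b ≡ fsuc fzero)

record Objective (n : ℕ) : Set where
  field
    wm : ℤ
    wx : Act n → ℤ
    wy : Act n → ℤ

objValue : {n : ℕ} → Objective n → Candidate n → ℤ
objValue {n} w s =
  Objective.wm w ℤ.* (+ toℕ (m s))
  ℤ.+ sumℤ (map (λ c → Objective.wx w c ℤ.* (+ toℕ (x s c))) (allActs n))
  ℤ.+ sumℤ (map (λ c → Objective.wy w c ℤ.* (+ toℕ (y s c))) (allActs n))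
  where
  sumℤ : List ℤ → ℤ
  sumℤ [] = + 0
  sumℤ (z ∷ zs) = z ℤ.+ sumℤ zs

IsSolution : {n : ℕ} → Objective n → Log (Act n) → Act n → Act n → Candidate n → Set
IsSolution w L' a b s =
  Feasible L' a b s × (∀ s' → Feasible L' a b s' → objValue w s ℤ.≤ objValue w s')

record Net (Λ : Set) : Set₁ where
  field
    Pl   : Set
    Tr   : Set
    pre  : Pl → Tr → Bool
    post : Tr → Pl → Bool
    pᵢ   : Pl
    pₒ   : Pl
    lab  : Tr → Maybe Λ       -- nothing = τ (silent)

module _ {Λ : Set} (N : Net Λ) where
  open Net N

  Node : Set
  Node = Pl ⊎ Tr

  Flow : Node → Node → Set
  Flow (inj₁ p) (inj₂ t) = pre p t ≡ true
  Flow (inj₂ t) (inj₁ p) = post t p ≡ true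
  Flow _ _ = ⊥

  IsWFNet : Set
  IsWFNet =
      pᵢ ≢ pₒ
    × (∀ t → post t pᵢ ≡ false)
    × (∀ t → pre pₒ t ≡ false)
    × (∀ (v : Node) → Star Flow (inj₁ pᵢ) v × Star Flow v (inj₁ pₒ))

  Marking : Set
  Marking = Pl → ℕ

  Enabled : Marking → Tr → Set
  Enabled M t = ∀ p → pre p t ≡ true → 0 < M p

  fireAt : Marking → Tr → Pl → ℕ
  fireAt M t p =
    if pre p t ∧ not (post t p) then M p ∸ 1
    else if post t p ∧ not (pre p t) then suc (M p)
    else M p

  Fires : Marking → Tr → Marking → Set
  Fires M t M' = Enabled M t × (∀ p → M' p ≡ fireAt M t p)

  Step : Marking → Marking → Set
  Step M M' = ∃[ t ] Fires M t M'

  Reach : Marking → Marking → Set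
  Reach = Star Step

  IsSingleton : Marking → Pl → Set
  IsSingleton M p = ∀ q → (q ≡ p → M q ≡ 1) × (q ≢ p → M q ≡ 0)

  RelaxedSound : Set
  RelaxedSound =
    ∀ t → ∃[ Mi ] ∃[ M ] ∃[ M' ] ∃[ Mo ]
      ( IsSingleton Mi pᵢ × Reach Mi M × Fires M t M'
      × Reach M' Mo × IsSingleton Mo pₒ )

data Place (k : ℕ) : Set where
  p-i : Place k
  p-o : Place k
  p-c : Fin k → Place k        -- p_(a,b) for the k-th pair of C(L')

isOne : Fin 2 → Bool
isOne fzero = false
isOne (fsuc _) = true

isStart : {n : ℕ} → Act n → Bool
isStart aₛ = true
isStart _  = false

isFinal : {n : ℕ} → Act n → Bool
isFinal aₓ = true
isFinal _  = false

labelOf : {n : ℕ} → Act n → Maybe (Fin n)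
labelOf aₛ = nothing
labelOf aₓ = nothing
labelOf (act a) = just a

#pairs : {n : ℕ} → CausalOracle n → Log (Fin n) → ℕ
#pairs C L = length (CausalOracle.rel C (USE L))

pairAt : {n : ℕ} (C : CausalOracle n) (L : Log (Fin n)) → Fin (#pairs C L) → Act n × Act n
pairAt C L i = lookup (CausalOracle.rel C (USE L)) i

-- The net returned, given the chosen solution for each pair of C(L').
discover : {n : ℕ} (L : Log (Fin n)) (C : CausalOracle n)
           (sol : Fin (#pairs C L) → Candidate n) → Net (Fin n)
discover {n} L C sol = record
  { Pl   = Place (#pairs C L)
  ; Tr   = Act n
  ; pre  = preF
  ; post = postF
  ; pᵢ   = p-i
  ; pₒ   = p-o
  ; lab  = labelOf
  }
  where
  preF : Place (#pairs C L) → Act n → Bool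
  preF p-i t = isStart t
  preF p-o t = false
  preF (p-c i) t = isOne (y (sol i) t)
  postF : Act n → Place (#pairs C L) → Bool
  postF t p-i = false
  postF t p-o = isFinal t
  postF t (p-c i) = isOne (x (sol i) t)

-- Every trace τ of USE(L) can be replayed in the discovered net.  For a
-- prefix ρ of τ let  marking ρ  put 1 ∸ |ρ| tokens on pᵢ, the number of a_f's
-- of ρ on pₒ, and  p(ρ)ᵀx ∸ p(ρ)ᵀy  tokens on the place p_(a,b) built from the
-- solution (0, x, y).  The prefix constraints of the ILP say exactly that the
-- next activity of τ is enabled in  marking ρ  and that firing it yields the
-- marking of the longer prefix; the trace constraints say that every place
-- p_(a,b) is empty after the whole trace, so  marking [] = [pᵢ]  and
-- marking τ = [pₒ].  Since every transition occurs in some trace of USE(L)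
-- (t_{a_s} and t_{a_f} in all of them, t_a because a occurs in L), each one
-- lies on a run from [pᵢ] to [pₒ].  The only exception is the empty log; then
-- the oracle returns no pair, only t_{a_s} is reachable from pᵢ, and the net
-- is not a workflow net at all.

module Submission where

open import Defs
open import Data.Nat using (ℕ; zero; suc; _+_; _*_; _∸_; _≤_; _<_; z≤n; s≤s)
open import Data.Nat.Properties
open import Data.Nat.ListAction using (sum)
open import Algebra.Properties.CommutativeSemigroup +-commutativeSemigroup using (interchange)
open import Data.Fin using (Fin; toℕ) renaming (zero to fzero; suc to fsuc)
open import Data.Fin.Properties using () renaming (suc-injective to fsuc-injective)
open import Data.Bool using (Bool; true; _∧_; not; if_then_else_)
open import Data.List using (List; []; _∷_; _++_; [_]; map; filter; length; allFin; tabulate)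
open import Data.List.Properties using (map-tabulate; map-∘; map-cong; map-++; ++-assoc; ++-identityʳ; length-++; filter-++; ∷-injectiveʳ)
open import Data.List.Membership.Propositional using (_∈_)
open import Data.List.Membership.Propositional.Properties using (∈-map⁺; ∈-∃++; ∈-lookup)
open import Data.List.Relation.Unary.Any using (here)
open import Data.Product using (∃-syntax; _×_; _,_; proj₁; proj₂)
open import Data.Sum using (inj₁; inj₂)
open import Data.Empty using (⊥; ⊥-elim)
open import Data.Unit using (⊤; tt)
open import Relation.Nullary using (yes; no)
open import Relation.Binary.PropositionalEquality hiding ([_])
open import Relation.Binary.Construct.Closure.ReflexiveTransitive using (Star; ε; _◅_; fold)
open import Function using (_∘_)

open ≡-Reasoning

sum-map-zero : {A : Set} (f : A → ℕ) (xs : List A) → (∀ a → f a ≡ 0) → sum (map f xs) ≡ 0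
sum-map-zero f []       vanish = refl
sum-map-zero f (a ∷ xs) vanish rewrite vanish a = sum-map-zero f xs vanish

sum-map-+ : {A : Set} (f g : A → ℕ) (xs : List A) →
            sum (map (λ a → f a + g a) xs) ≡ sum (map f xs) + sum (map g xs)
sum-map-+ f g []       = refl
sum-map-+ f g (a ∷ xs) = begin
  (f a + g a) + sum (map (λ a → f a + g a) xs)     ≡⟨ cong ((f a + g a) +_) (sum-map-+ f g xs) ⟩
  (f a + g a) + (sum (map f xs) + sum (map g xs))  ≡⟨ interchange (f a) (g a) _ _ ⟩
  (f a + sum (map f xs)) + (g a + sum (map g xs))  ∎

map-tabulate-suc : ∀ {n} (h : Fin (suc n) → ℕ) → map h (tabulate fsuc) ≡ map (h ∘ fsuc) (allFin n)
map-tabulate-suc h = trans (map-tabulate fsuc h) (sym (map-tabulate (λ j → j) (h ∘ fsuc)))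

sum-allFin-single : ∀ n (h : Fin n → ℕ) (i : Fin n) →
                    (∀ j → j ≢ i → h j ≡ 0) → sum (map h (allFin n)) ≡ h i
sum-allFin-single (suc n) h fzero vanish = begin
  h fzero + sum (map h (tabulate fsuc))       ≡⟨ cong (λ xs → h fzero + sum xs) (map-tabulate-suc h) ⟩
  h fzero + sum (map (h ∘ fsuc) (allFin n))
    ≡⟨ cong (h fzero +_) (sum-map-zero (h ∘ fsuc) (allFin n) (λ j → vanish (fsuc j) (λ ()))) ⟩
  h fzero + 0                                 ≡⟨ +-identityʳ (h fzero) ⟩
  h fzero                                     ∎
sum-allFin-single (suc n) h (fsuc i) vanish = begin
  h fzero + sum (map h (tabulate fsuc))
    ≡⟨ cong₂ (λ u xs → u + sum xs) (vanish fzero (λ ())) (map-tabulate-suc h) ⟩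
  sum (map (h ∘ fsuc) (allFin n))
    ≡⟨ sum-allFin-single n (h ∘ fsuc) i (λ j j≢i → vanish (fsuc j) (j≢i ∘ fsuc-injective)) ⟩
  h (fsuc i)                                  ∎

act-injective : ∀ {n} {i j : Fin n} → act i ≡ act j → i ≡ j
act-injective refl = refl

sum-allActs-single : ∀ {n} (g : Act n → ℕ) (c : Act n) →
                     (∀ c' → c' ≢ c → g c' ≡ 0) → sum (map g (allActs n)) ≡ g c
sum-allActs-single {n} g c vanish with c
... | aₛ = begin
  g aₛ + (g aₓ + rest)  ≡⟨ cong₂ (λ u v → g aₛ + (u + v)) (vanish aₓ (λ ())) acts-vanish ⟩
  g aₛ + 0              ≡⟨ +-identityʳ (g aₛ) ⟩
  g aₛ                  ∎
  where
  rest = sum (map g (map act (allFin n)))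
  acts-vanish : rest ≡ 0
  acts-vanish = trans (cong sum (sym (map-∘ (allFin n))))
                      (sum-map-zero (g ∘ act) (allFin n) (λ j → vanish (act j) (λ ())))
... | aₓ = begin
  g aₛ + (g aₓ + rest)  ≡⟨ cong₂ (λ u v → u + (g aₓ + v)) (vanish aₛ (λ ())) acts-vanish ⟩
  g aₓ + 0              ≡⟨ +-identityʳ (g aₓ) ⟩
  g aₓ                  ∎
  where
  rest = sum (map g (map act (allFin n)))
  acts-vanish : rest ≡ 0
  acts-vanish = trans (cong sum (sym (map-∘ (allFin n))))
                      (sum-map-zero (g ∘ act) (allFin n) (λ j → vanish (act j) (λ ())))
... | act i = begin
  g aₛ + (g aₓ + rest)  ≡⟨ cong₂ (λ u v → u + (v + rest)) (vanish aₛ (λ ())) (vanish aₓ (λ ())) ⟩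
  rest                  ≡⟨ cong sum (sym (map-∘ (allFin n))) ⟩
  sum (map (g ∘ act) (allFin n))
    ≡⟨ sum-allFin-single n (g ∘ act) i (λ j j≢i → vanish (act j) (j≢i ∘ act-injective)) ⟩
  g (act i)             ∎
  where
  rest = sum (map g (map act (allFin n)))

parikh-++ : ∀ {n} (ρ ρ' : Trace (Act n)) (c : Act n) → parikh (ρ ++ ρ') c ≡ parikh ρ c + parikh ρ' c
parikh-++ ρ ρ' c = trans (cong length (filter-++ (c ≟A_) ρ ρ')) (length-++ (filter (c ≟A_) ρ))

parikh-single-≢ : ∀ {n} (c c' : Act n) → c' ≢ c → parikh [ c ] c' ≡ 0
parikh-single-≢ c c' c'≢c with c' ≟A c
... | yes c'≡c = ⊥-elim (c'≢c c'≡c)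
... | no _     = refl

parikh-single-≡ : ∀ {n} (c : Act n) → parikh [ c ] c ≡ 1
parikh-single-≡ c with c ≟A c
... | yes _   = refl
... | no c≢c  = ⊥-elim (c≢c refl)

dot-+ : ∀ {n} (p q : Act n → ℕ) (v : Act n → Fin 2) →
        dot (λ c → p c + q c) v ≡ dot p v + dot q v
dot-+ {n} p q v = begin
  sum (map (λ c → (p c + q c) * toℕ (v c)) (allActs n))
    ≡⟨ cong sum (map-cong (λ c → *-distribʳ-+ (toℕ (v c)) (p c) (q c)) (allActs n)) ⟩
  sum (map (λ c → p c * toℕ (v c) + q c * toℕ (v c)) (allActs n))
    ≡⟨ sum-map-+ (λ c → p c * toℕ (v c)) (λ c → q c * toℕ (v c)) (allActs n) ⟩
  dot p v + dot q v ∎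

dot-++ : ∀ {n} (ρ ρ' : Trace (Act n)) (v : Act n → Fin 2) →
         dot (parikh (ρ ++ ρ')) v ≡ dot (parikh ρ) v + dot (parikh ρ') v
dot-++ {n} ρ ρ' v =
  trans (cong sum (map-cong (λ c → cong (_* toℕ (v c)) (parikh-++ ρ ρ' c)) (allActs n)))
        (dot-+ (parikh ρ) (parikh ρ') v)

dot-single : ∀ {n} (c : Act n) (v : Act n → Fin 2) → dot (parikh [ c ]) v ≡ toℕ (v c)
dot-single c v = begin
  dot (parikh [ c ]) v         ≡⟨ sum-allActs-single (λ c' → parikh [ c ] c' * toℕ (v c')) c
                                    (λ c' c'≢c → cong (_* toℕ (v c')) (parikh-single-≢ c c' c'≢c)) ⟩
  parikh [ c ] c * toℕ (v c)   ≡⟨ cong (_* toℕ (v c)) (parikh-single-≡ c) ⟩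
  toℕ (v c) + 0                ≡⟨ +-identityʳ (toℕ (v c)) ⟩
  toℕ (v c)                    ∎

dot-snoc : ∀ {n} (ρ : Trace (Act n)) (c : Act n) (v : Act n → Fin 2) →
           dot (parikh (ρ ++ [ c ])) v ≡ dot (parikh ρ) v + toℕ (v c)
dot-snoc ρ c v = trans (dot-++ ρ [ c ] v) (cong (dot (parikh ρ) v +_) (dot-single c v))

dot-empty : ∀ {n} (v : Act n → Fin 2) → dot (parikh []) v ≡ 0
dot-empty {n} v = sum-map-zero _ (allActs n) (λ _ → refl)


afterFiring : Bool → Bool → ℕ → ℕ
afterFiring i o k = if i ∧ not o then k ∸ 1 else if o ∧ not i then suc k else k

counter-enabled : ∀ (yc : Fin 2) X Y → Y + toℕ yc ≤ X → isOne yc ≡ true → 0 < X ∸ Y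
counter-enabled (fsuc fzero) X Y budget _ = m<n⇒0<n∸m (subst (_≤ X) (+-comm Y 1) budget)

counter-update : ∀ (yc xc : Fin 2) X Y → Y + toℕ yc ≤ X →
                 afterFiring (isOne yc) (isOne xc) (X ∸ Y) ≡ (X + toℕ xc) ∸ (Y + toℕ yc)
counter-update fzero fzero X Y _ = sym (cong₂ _∸_ (+-identityʳ X) (+-identityʳ Y))
counter-update fzero (fsuc fzero) X Y budget = sym (begin
  (X + 1) ∸ (Y + 0)  ≡⟨ cong ((X + 1) ∸_) (+-identityʳ Y) ⟩
  (X + 1) ∸ Y        ≡⟨ +-∸-comm 1 (subst (_≤ X) (+-identityʳ Y) budget) ⟩
  (X ∸ Y) + 1        ≡⟨ +-comm (X ∸ Y) 1 ⟩
  suc (X ∸ Y)        ∎)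
counter-update (fsuc fzero) fzero X Y _ = begin
  (X ∸ Y) ∸ 1        ≡⟨ ∸-+-assoc X Y 1 ⟩
  X ∸ (Y + 1)        ≡⟨ cong (_∸ (Y + 1)) (sym (+-identityʳ X)) ⟩
  (X + 0) ∸ (Y + 1)  ∎
counter-update (fsuc fzero) (fsuc fzero) X Y _ = sym (begin
  (X + 1) ∸ (Y + 1)  ≡⟨ cong₂ _∸_ (+-comm X 1) (+-comm Y 1) ⟩
  (1 + X) ∸ (1 + Y)  ≡⟨ [m+n]∸[m+o]≡n∸o 1 X Y ⟩
  X ∸ Y              ∎)

useTrace : ∀ {n} → Trace (Fin n) → Trace (Act n)
useTrace σ = aₛ ∷ (map act σ ++ [ aₓ ])

no-final-in-body : ∀ {n} (σ : Trace (Fin n)) → parikh (map act σ) aₓ ≡ 0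
no-final-in-body []      = refl
no-final-in-body (_ ∷ σ) = no-final-in-body σ

no-start-in-tail : ∀ {n} (ρ r : Trace (Act n)) (σ : Trace (Fin n)) → ρ ++ aₛ ∷ r ≢ map act σ ++ [ aₓ ]
no-start-in-tail []      r []      ()
no-start-in-tail []      r (_ ∷ σ) ()
no-start-in-tail (_ ∷ []) r []     ()
no-start-in-tail (_ ∷ _ ∷ _) r []  ()
no-start-in-tail (_ ∷ ρ) r (_ ∷ σ) eq = no-start-in-tail ρ r σ (∷-injectiveʳ eq)

SoundAt : {Λ : Set} (N : Net Λ) → Net.Tr N → Set
SoundAt N t = ∃[ Mi ] ∃[ M ] ∃[ M' ] ∃[ Mo ]
  ( IsSingleton N Mi (Net.pᵢ N) × Reach N Mi M × Fires N M t M'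
  × Reach N M' Mo × IsSingleton N Mo (Net.pₒ N) )

module Replay {n : ℕ} (L : Log (Fin n)) (C : CausalOracle n)
  (sol : Fin (#pairs C L) → Candidate n)
  (feasible : ∀ i → Feasible (USE L) (proj₁ (pairAt C L i)) (proj₂ (pairAt C L i)) (sol i)) where

  N : Net (Fin n)
  N = discover L C sol

  marking : Trace (Act n) → Place (#pairs C L) → ℕ
  marking ρ p-i     = 1 ∸ length ρ
  marking ρ p-o     = parikh ρ aₓ
  marking ρ (p-c i) = dot (parikh ρ) (x (sol i)) ∸ dot (parikh ρ) (y (sol i))

  m-zero : ∀ i → m (sol i) ≡ fzero
  m-zero i = proj₁ (proj₂ (proj₂ (proj₂ (feasible i))))

  prefix-budget : ∀ i ρ c → InPrefixClosure (ρ ++ [ c ]) (USE L) →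
                  dot (parikh ρ) (y (sol i)) + toℕ (y (sol i) c) ≤ dot (parikh ρ) (x (sol i))
  prefix-budget i ρ c prefix =
    subst₂ _≤_ (dot-snoc ρ c (y (sol i))) (cong (λ z → toℕ z + dot (parikh ρ) (x (sol i))) (m-zero i))
      (proj₁ (feasible i) ρ c prefix)

  trace-balance : ∀ i τ → τ ∈ USE L → dot (parikh τ) (x (sol i)) ≡ dot (parikh τ) (y (sol i))
  trace-balance i τ τ∈ =
    subst (λ z → toℕ z + dot (parikh τ) (x (sol i)) ≡ dot (parikh τ) (y (sol i))) (m-zero i)
      (proj₁ (proj₂ (feasible i)) τ τ∈)

  module _ (σ : Trace (Fin n)) (σ∈L : σ ∈ L) where

    τ : Trace (Act n)
    τ = useTrace σ

    τ∈USE : τ ∈ USE L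
    τ∈USE = ∈-map⁺ useTrace σ∈L

    budget : ∀ ρ c r → ρ ++ c ∷ r ≡ τ → ∀ i →
             dot (parikh ρ) (y (sol i)) + toℕ (y (sol i) c) ≤ dot (parikh ρ) (x (sol i))
    budget ρ c r split i = prefix-budget i ρ c (τ , τ∈USE , r , trans (++-assoc ρ [ c ] r) split)

    enabled : ∀ ρ c r → ρ ++ c ∷ r ≡ τ → Enabled N (marking ρ) c
    enabled []      c  r split p-i _ = s≤s z≤n
    enabled (_ ∷ ρ) aₛ r split p-i _ = ⊥-elim (no-start-in-tail ρ r σ (∷-injectiveʳ split))
    enabled ρ c r split (p-c i) arc =
      counter-enabled (y (sol i) c) _ _ (budget ρ c r split i) arc

    after : ∀ ρ c r → ρ ++ c ∷ r ≡ τ → ∀ p →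
            marking (ρ ++ [ c ]) p ≡ fireAt N (marking ρ) c p
    after []      aₛ      r split p-i = refl
    after (_ ∷ ρ) aₛ      r split p-i = ⊥-elim (no-start-in-tail ρ r σ (∷-injectiveʳ split))
    after (_ ∷ ρ) aₓ      r split p-i = trans (0∸n≡0 (length (ρ ++ [ aₓ ]))) (sym (0∸n≡0 (length ρ)))
    after (_ ∷ ρ) (act j) r split p-i = trans (0∸n≡0 (length (ρ ++ [ act j ]))) (sym (0∸n≡0 (length ρ)))
    after ρ aₛ      r split p-o = trans (parikh-++ ρ [ aₛ ] aₓ) (+-identityʳ _)
    after ρ aₓ      r split p-o = trans (parikh-++ ρ [ aₓ ] aₓ) (+-comm _ 1)
    after ρ (act j) r split p-o = trans (parikh-++ ρ [ act j ] aₓ) (+-identityʳ _)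
    after ρ c r split (p-c i) =
      trans (cong₂ _∸_ (dot-snoc ρ c (x (sol i))) (dot-snoc ρ c (y (sol i))))
            (sym (counter-update (y (sol i) c) (x (sol i) c) _ _ (budget ρ c r split i)))

    fires : ∀ ρ c r → ρ ++ c ∷ r ≡ τ → Fires N (marking ρ) c (marking (ρ ++ [ c ]))
    fires ρ c r split = enabled ρ c r split , after ρ c r split

    replay : ∀ ρ ρ' r → (ρ ++ ρ') ++ r ≡ τ → Reach N (marking ρ) (marking (ρ ++ ρ'))
    replay ρ [] r split = subst (λ z → Reach N (marking ρ) (marking z)) (sym (++-identityʳ ρ)) ε
    replay ρ (c ∷ ρ') r split =
      (c , fires ρ c (ρ' ++ r) (trans (sym (++-assoc ρ (c ∷ ρ') r)) split))
      ◅ subst (λ z → Reach N (marking (ρ ++ [ c ])) (marking z)) (++-assoc ρ [ c ] ρ')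
          (replay (ρ ++ [ c ]) ρ' r (trans (cong (_++ r) (++-assoc ρ [ c ] ρ')) split))

    initial : IsSingleton N (marking []) p-i
    initial p-i     = (λ _ → refl) , (λ p-i≢p-i → ⊥-elim (p-i≢p-i refl))
    initial p-o     = (λ ()) , (λ _ → refl)
    initial (p-c i) = (λ ()) , (λ _ → cong₂ _∸_ (dot-empty (x (sol i))) (dot-empty (y (sol i))))

    final : IsSingleton N (marking τ) p-o
    final p-i     = (λ ()) , (λ _ → 0∸n≡0 (length (map act σ ++ [ aₓ ])))
    final p-o     = (λ _ → trans (parikh-++ (map act σ) [ aₓ ] aₓ) (cong (_+ 1) (no-final-in-body σ)))
                  , (λ p-o≢p-o → ⊥-elim (p-o≢p-o refl))
    final (p-c i) = (λ ()) , (λ _ → begin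
      dot (parikh τ) (x (sol i)) ∸ dot (parikh τ) (y (sol i))
        ≡⟨ cong (dot (parikh τ) (x (sol i)) ∸_) (sym (trace-balance i τ τ∈USE)) ⟩
      dot (parikh τ) (x (sol i)) ∸ dot (parikh τ) (x (sol i))
        ≡⟨ n∸n≡0 (dot (parikh τ) (x (sol i))) ⟩
      0 ∎)

    sound-at : ∀ ρ t r → ρ ++ t ∷ r ≡ τ → SoundAt N t
    sound-at ρ t r split =
      marking [] , marking ρ , marking (ρ ++ [ t ]) , marking τ
      , initial , replay [] ρ (t ∷ r) split , fires ρ t r split
      , subst (λ z → Reach N (marking (ρ ++ [ t ])) (marking z)) rest-split
          (replay (ρ ++ [ t ]) r [] (trans (++-identityʳ _) rest-split))
      , final
      where
      rest-split : (ρ ++ [ t ]) ++ r ≡ τ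
      rest-split = trans (++-assoc ρ [ t ] r) split

OccursInUse : ∀ {n} → Act n → Log (Fin n) → Set
OccursInUse t L = ∃[ σ ] (σ ∈ L × ∃[ ρ ] ∃[ r ] (ρ ++ t ∷ r ≡ useTrace σ))

occurs-in-use : ∀ {n} (σ₀ : Trace (Fin n)) (L : Log (Fin n)) →
                (∀ a → Occurs a (σ₀ ∷ L)) → ∀ t → OccursInUse t (σ₀ ∷ L)
occurs-in-use σ₀ L covers aₛ = σ₀ , here refl , [] , map act σ₀ ++ [ aₓ ] , refl
occurs-in-use σ₀ L covers aₓ = σ₀ , here refl , aₛ ∷ map act σ₀ , [] , refl
occurs-in-use σ₀ L covers (act a) with covers a
... | σ , σ∈ , a∈σ with ∈-∃++ a∈σ
... | ys , zs , refl = ys ++ a ∷ zs , σ∈ , aₛ ∷ map act ys , map act zs ++ [ aₓ ] , cong (aₛ ∷_) (sym (begin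
  map act (ys ++ a ∷ zs) ++ [ aₓ ]            ≡⟨ cong (_++ [ aₓ ]) (map-++ act ys (a ∷ zs)) ⟩
  (map act ys ++ act a ∷ map act zs) ++ [ aₓ ] ≡⟨ ++-assoc (map act ys) (act a ∷ map act zs) [ aₓ ] ⟩
  map act ys ++ act a ∷ (map act zs ++ [ aₓ ]) ∎))

module EmptyLog {n : ℕ} (C : CausalOracle n) (sol : Fin (#pairs C []) → Candidate n) where

  N : Net (Fin n)
  N = discover [] C sol

  -- The oracle relates only activities of the log, so on USE([]) it returns no pair.
  no-pairs : Fin (#pairs C []) → ⊥
  no-pairs i with CausalOracle.its-acts C [] _ _ (∈-lookup i)
  ... | (_ , () , _) , _

  -- The nodes reachable from pᵢ: pᵢ itself and t_{a_s}.
  NearStart : Node N → Set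
  NearStart (inj₁ p-i) = ⊤
  NearStart (inj₂ aₛ)  = ⊤
  NearStart _          = ⊥

  flow-near-start : ∀ {u v} → Flow N u v → NearStart u → NearStart v
  flow-near-start {inj₁ p-i} {inj₂ aₛ}      _ _ = tt
  flow-near-start {inj₁ p-i} {inj₂ aₓ}      () _
  flow-near-start {inj₁ p-i} {inj₂ (act _)} () _
  flow-near-start {inj₂ aₛ}  {inj₁ (p-c i)} _ _ = ⊥-elim (no-pairs i)
  flow-near-start {inj₂ aₛ}  {inj₁ p-o}     () _

  reach-near-start : ∀ {u v} → Star (Flow N) u v → NearStart u → NearStart v
  reach-near-start = fold (λ u v → NearStart u → NearStart v)
                          (λ flow rest → rest ∘ flow-near-start flow) (λ near → near)

  not-WF : IsWFNet N → ⊥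
  not-WF (_ , _ , _ , connected) = reach-near-start (proj₂ (connected (inj₁ p-i))) tt

theorem2 : (n : ℕ) (L : Log (Fin n))
           → (∀ (a : Fin n) → Occurs a L)
           → (C : CausalOracle n) (w : Objective n)
           → (sol : Fin (#pairs C L) → Candidate n)
           → (∀ i → IsSolution w (USE L) (proj₁ (pairAt C L i)) (proj₂ (pairAt C L i)) (sol i))
           → IsWFNet (discover L C sol)
           → RelaxedSound (discover L C sol)
theorem2 n []        covers C w sol solutions wf = ⊥-elim (EmptyLog.not-WF C sol wf)
theorem2 n (σ₀ ∷ L) covers C w sol solutions wf t
  with occurs-in-use σ₀ L covers t
... | σ , σ∈ , ρ , r , split =
  Replay.sound-at (σ₀ ∷ L) C sol (λ i → proj₁ (solutions i)) σ σ∈ ρ t r split
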